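{- Let $f$ be a primitive $k$-regular sequence with the data described in the context. Then for every $n\geqslant 1$ the matrix ${\bf A}_n(1)$ is a Markov matrix (its entries are non-negative and each of its rows sums to $1$).
   Context: Let $k\geqslant 2$ be an integer. For an integer sequence $f$ its $k$-kernel is $\ker_k(f)=\{(f(k^\ell n+r))_{n\geqslant 0}:\ell\geqslant 0,\ 0\leqslant r<k^\ell\}$; $f$ is $k$-regular if the $\mathbb{Q}$-span $\mathcal{V}_k(f)$ of $\ker_k(f)$ is finite-dimensional. Fix a basis $\{f=f_1,\ldots,f_d\}\subseteq\ker_k(f)$ of $\mathcal{V}_k(f)$ of integer sequences, put ${\bf f}(m)=(f_1(m),\ldots,f_d(m))^T$, and let ${\bf B}_a$ ($0\leqslant a\leqslant k-1$) be the $d\times d$ integer matrices with ${\bf f}(km+a)={\bf B}_a{\bf f}(m)$ for all $m\geqslant 0$; ${\bf B}=\sum_a{\bf B}_a$. $f$ is primitive if $f$ takes non-negative integer values, is not eventually zero, each ${\bf B}_a$ is entrywise non-negative and ${\bf B}$ is entrywise positive. Let $\varSigma_i(n)=\sum_{m=k^n}^{k^{n+1}-1}f_i(m)$ (non-zero for primitive $f$). Let ${\bf B}(z)=\sum_{a=0}^{k-1}{\bf B}_az^a=(b_{ij}(z))_{1\leqslant i,j\leqslant d}$ and for $n\geqslant 1$ let ${\bf A}_n(z)=\big(\varSigma_j(n-1)\,b_{ij}(z)/\varSigma_i(n)\big)_{1\leqslant i,j\leqslant d}$. -}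

module Defs where

open import Data.Nat as ℕ using (ℕ; zero; suc; _^_; _∸_)
open import Data.Integer as ℤ using (ℤ)
open import Data.Rational as ℚ using (ℚ; 0ℚ; _≟_; _÷_; ≢-nonZero)
open import Data.Fin using (Fin)
import Data.Fin as Fin
open import Relation.Nullary using (yes; no)

sumFinℤ : (n : ℕ) → (Fin n → ℤ) → ℤ
sumFinℤ zero    g = ℤ.0ℤ
sumFinℤ (suc n) g = g Fin.zero ℤ.+ sumFinℤ n (λ i → g (Fin.suc i))

sumFinℚ : (n : ℕ) → (Fin n → ℚ) → ℚ
sumFinℚ zero    g = 0ℚ
sumFinℚ (suc n) g = g Fin.zero ℚ.+ sumFinℚ n (λ i → g (Fin.suc i))

sumRange : ℕ → ℕ → (ℕ → ℤ) → ℤ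
sumRange a zero      g = ℤ.0ℤ
sumRange a (suc len) g = g a ℤ.+ sumRange (suc a) len g

blockSum : (k : ℕ) → (ℕ → ℤ) → ℕ → ℤ
blockSum k g n = sumRange (k ^ n) (k ^ suc n ∸ k ^ n) g

-- division on ℚ; the value at denominator 0 is an (irrelevant) junk value 0
_/'_ : ℚ → ℚ → ℚ
p /' q with q ≟ 0ℚ
... | yes _  = 0ℚ
... | no q≢0 = _÷_ p q {{≢-nonZero q≢0}}

-- b_{ij}(1) where B(z) = Σ_a B_a z^a
Bat1 : (k d : ℕ) → (Fin k → Fin d → Fin d → ℤ) → Fin d → Fin d → ℤ
Bat1 k d B i j = sumFinℤ k (λ a → B a i j)

A1 : (k d : ℕ) → (fs : Fin d → ℕ → ℤ) → (B : Fin k → Fin d → Fin d → ℤ)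
   → ℕ → Fin d → Fin d → ℚ
A1 k d fs B n i j =
  (ℚ._/_ (blockSum k (fs j) (n ∸ 1) ℤ.* Bat1 k d B i j) 1)
    /' (ℚ._/_ (blockSum k (fs i) n) 1)

-- Cutting the block [k^n, k^(n+1)) into the digit blocks [k m, k m + k) and
-- applying f_i(k m + a) = Σ_j (B_a)_ij f_j(m) gives Σ_i(n) = Σ_j Σ_j(n-1) b_ij(1),
-- so every row of A_n(1) sums to 1 as soon as Σ_i(n) > 0.  For positivity, f is
-- non-zero at some m ≥ k^(n-1); stripping last digits of m along non-zero entries
-- of the B_a keeps some f_l non-zero until the argument lies in the block of
-- level n-1, so some Σ_l(n-1) > 0, and B(1) > 0 spreads this to every Σ_i(n).
module Submission where

open import Defs
open import Data.Nat as ℕ using (ℕ; zero; suc; _^_; _+_; _*_; _<_; _≤_)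
open import Data.Integer as ℤ using (ℤ)
open import Data.Rational as ℚ using (ℚ)
open import Data.Fin using (Fin; toℕ)
import Data.Fin as Fin
open import Data.Product using (Σ; _×_)
open import Relation.Binary.PropositionalEquality using (_≡_; _≢_)

open import Algebra.Bundles using (Ring)
open import Data.Empty using (⊥-elim)
open import Data.Nat using (_∸_; _/_; NonZero)
open import Data.Nat.DivMod using (_mod_; _divMod_; module DivMod; /-monoˡ-≤; m*n/n≡m; m/n<m)
open import Data.Nat.Induction using (<-rec)
import Data.Nat.Properties as ℕP
import Data.Integer.Properties as ℤP
import Data.Rational.Properties as ℚP
open import Data.Nat.Coprimality using (1-coprimeTo)
import Data.Nat.Coprimality as Coprimality
open import Data.Product using (_,_; proj₁; proj₂; ∃)
open import Relation.Nullary using (yes; no)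
open import Relation.Binary.PropositionalEquality
  using (refl; sym; trans; cong; cong₂; subst; module ≡-Reasoning)

import Algebra.Properties.Semiring.Sum ℤP.+-*-semiring as ℤΣ
import Algebra.Properties.Semiring.Sum (Ring.semiring ℚP.+-*-ring) as ℚΣ

open import Data.Integer using (0ℤ)
open import Data.Rational using (0ℚ; 1ℚ)

sumFinℤ≡sum : ∀ n (g : Fin n → ℤ) → sumFinℤ n g ≡ ℤΣ.sum g
sumFinℤ≡sum zero    g = refl
sumFinℤ≡sum (suc n) g = cong (ℤ._+_ (g Fin.zero)) (sumFinℤ≡sum n (λ i → g (Fin.suc i)))

sumFinℚ≡sum : ∀ n (g : Fin n → ℚ) → sumFinℚ n g ≡ ℚΣ.sum g
sumFinℚ≡sum zero    g = refl
sumFinℚ≡sum (suc n) g = cong (ℚ._+_ (g Fin.zero)) (sumFinℚ≡sum n (λ i → g (Fin.suc i)))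

sumFinℤ-cong : ∀ n {g h : Fin n → ℤ} → (∀ i → g i ≡ h i) → sumFinℤ n g ≡ sumFinℤ n h
sumFinℤ-cong n {g} {h} g≗h =
  trans (sumFinℤ≡sum n g) (trans (ℤΣ.sum-cong-≗ g≗h) (sym (sumFinℤ≡sum n h)))

sumFinℚ-cong : ∀ n {g h : Fin n → ℚ} → (∀ i → g i ≡ h i) → sumFinℚ n g ≡ sumFinℚ n h
sumFinℚ-cong n {g} {h} g≗h =
  trans (sumFinℚ≡sum n g) (trans (ℚΣ.sum-cong-≗ g≗h) (sym (sumFinℚ≡sum n h)))

sumFinℤ-comm : ∀ m n (g : Fin m → Fin n → ℤ) →
  sumFinℤ m (λ a → sumFinℤ n (g a)) ≡ sumFinℤ n (λ b → sumFinℤ m (λ a → g a b))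
sumFinℤ-comm m n g = begin
  sumFinℤ m (λ a → sumFinℤ n (g a))        ≡⟨ sumFinℤ-cong m (λ a → sumFinℤ≡sum n (g a)) ⟩
  sumFinℤ m (λ a → ℤΣ.sum (g a))           ≡⟨ sumFinℤ≡sum m _ ⟩
  ℤΣ.sum (λ a → ℤΣ.sum (g a))              ≡⟨ ℤΣ.∑-comm g ⟩
  ℤΣ.sum (λ b → ℤΣ.sum (λ a → g a b))      ≡⟨ sumFinℤ≡sum n _ ⟨
  sumFinℤ n (λ b → ℤΣ.sum (λ a → g a b))   ≡⟨ sumFinℤ-cong n (λ b → sumFinℤ≡sum m (λ a → g a b)) ⟨
  sumFinℤ n (λ b → sumFinℤ m (λ a → g a b)) ∎
  where open ≡-Reasoning

sumFinℤ-distribʳ : ∀ n (g : Fin n → ℤ) c → sumFinℤ n (λ i → g i ℤ.* c) ≡ sumFinℤ n g ℤ.* c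
sumFinℤ-distribʳ n g c = trans (sumFinℤ≡sum n _)
  (trans (sym (ℤΣ.*-distribʳ-sum c g)) (cong (ℤ._* c) (sym (sumFinℤ≡sum n g))))

sumFinℚ-distribʳ : ∀ n (g : Fin n → ℚ) c → sumFinℚ n (λ i → g i ℚ.* c) ≡ sumFinℚ n g ℚ.* c
sumFinℚ-distribʳ n g c = trans (sumFinℚ≡sum n _)
  (trans (sym (ℚΣ.*-distribʳ-sum c g)) (cong (ℚ._* c) (sym (sumFinℚ≡sum n g))))

sumFinℤ-nonNeg : ∀ n (g : Fin n → ℤ) → (∀ i → 0ℤ ℤ.≤ g i) → 0ℤ ℤ.≤ sumFinℤ n g
sumFinℤ-nonNeg zero    g g≥0 = ℤP.≤-refl
sumFinℤ-nonNeg (suc n) g g≥0 =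
  ℤP.+-mono-≤ (g≥0 Fin.zero) (sumFinℤ-nonNeg n _ (λ i → g≥0 (Fin.suc i)))

sumFinℤ-pos : ∀ n (g : Fin n → ℤ) → (∀ i → 0ℤ ℤ.≤ g i) → ∀ j → 0ℤ ℤ.< g j → 0ℤ ℤ.< sumFinℤ n g
sumFinℤ-pos (suc n) g g≥0 Fin.zero    gj>0 =
  ℤP.+-mono-<-≤ gj>0 (sumFinℤ-nonNeg n _ (λ i → g≥0 (Fin.suc i)))
sumFinℤ-pos (suc n) g g≥0 (Fin.suc j) gj>0 =
  ℤP.+-mono-≤-< (g≥0 Fin.zero) (sumFinℤ-pos n _ (λ i → g≥0 (Fin.suc i)) j gj>0)

sumFinℤ-pos⇒∃pos : ∀ n (g : Fin n → ℤ) → 0ℤ ℤ.< sumFinℤ n g → ∃ λ j → 0ℤ ℤ.< g j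
sumFinℤ-pos⇒∃pos zero    g (ℤ.+<+ ())
sumFinℤ-pos⇒∃pos (suc n) g Σg>0 with 0ℤ ℤP.<? g Fin.zero
... | yes g₀>0 = Fin.zero , g₀>0
... | no  g₀≯0 with sumFinℤ-pos⇒∃pos n (λ i → g (Fin.suc i)) rest>0
  where
    rest>0 : 0ℤ ℤ.< sumFinℤ n (λ i → g (Fin.suc i))
    rest>0 = ℤP.<-≤-trans Σg>0
      (ℤP.≤-trans (ℤP.+-monoˡ-≤ _ (ℤP.≮⇒≥ g₀≯0)) (ℤP.≤-reflexive (ℤP.+-identityˡ _)))
... | j , gj>0 = Fin.suc j , gj>0

i≥0∧j≥0⇒i*j≥0 : ∀ {i j} → 0ℤ ℤ.≤ i → 0ℤ ℤ.≤ j → 0ℤ ℤ.≤ i ℤ.* j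
i≥0∧j≥0⇒i*j≥0 {i} {j} i≥0 j≥0 =
  ℤP.≤-trans (ℤP.≤-reflexive (sym (ℤP.*-zeroʳ i)))
             (ℤP.*-monoˡ-≤-nonNeg i {{ℤ.nonNegative i≥0}} j≥0)

i>0∧j>0⇒i*j>0 : ∀ {i j} → 0ℤ ℤ.< i → 0ℤ ℤ.< j → 0ℤ ℤ.< i ℤ.* j
i>0∧j>0⇒i*j>0 {i} {j} i>0 j>0 =
  ℤP.≤-<-trans (ℤP.≤-reflexive (sym (ℤP.*-zeroʳ i)))
               (ℤP.*-monoˡ-<-pos i {{ℤ.positive i>0}} j>0)

i*j>0∧j≥0⇒j>0 : ∀ i {j} → 0ℤ ℤ.≤ j → 0ℤ ℤ.< i ℤ.* j → 0ℤ ℤ.< j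
i*j>0∧j≥0⇒j>0 i {j} j≥0 ij>0 = ℤP.≤∧≢⇒< j≥0 λ 0≡j →
  ℤP.<-irrefl (sym (trans (cong (i ℤ.*_) (sym 0≡j)) (ℤP.*-zeroʳ i))) ij>0

sumRange-cong : ∀ a len {g h : ℕ → ℤ} → (∀ m → g m ≡ h m) → sumRange a len g ≡ sumRange a len h
sumRange-cong a zero      g≗h = refl
sumRange-cong a (suc len) g≗h = cong₂ ℤ._+_ (g≗h a) (sumRange-cong (suc a) len g≗h)

sumRange≡sumFinℤ : ∀ a len (g : ℕ → ℤ) → sumRange a len g ≡ sumFinℤ len (λ t → g (a + toℕ t))
sumRange≡sumFinℤ a zero      g = refl
sumRange≡sumFinℤ a (suc len) g = cong₂ ℤ._+_ (cong g (sym (ℕP.+-identityʳ a)))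
  (trans (sumRange≡sumFinℤ (suc a) len g)
         (sumFinℤ-cong len (λ t → cong g (sym (ℕP.+-suc a (toℕ t))))))

sumRange-+ : ∀ a m n (g : ℕ → ℤ) → sumRange a (m + n) g ≡ sumRange a m g ℤ.+ sumRange (a + m) n g
sumRange-+ a zero    n g =
  trans (cong (λ b → sumRange b n g) (sym (ℕP.+-identityʳ a))) (sym (ℤP.+-identityˡ _))
sumRange-+ a (suc m) n g = begin
  g a ℤ.+ sumRange (suc a) (m + n) g
    ≡⟨ cong (ℤ._+_ (g a)) (sumRange-+ (suc a) m n g) ⟩
  g a ℤ.+ (sumRange (suc a) m g ℤ.+ sumRange (suc a + m) n g)
    ≡⟨ cong (λ b → g a ℤ.+ (sumRange (suc a) m g ℤ.+ sumRange b n g)) (sym (ℕP.+-suc a m)) ⟩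
  g a ℤ.+ (sumRange (suc a) m g ℤ.+ sumRange (a + suc m) n g)
    ≡⟨ ℤP.+-assoc (g a) _ _ ⟨
  g a ℤ.+ sumRange (suc a) m g ℤ.+ sumRange (a + suc m) n g ∎
  where open ≡-Reasoning

sumRange-digits : ∀ k a len (g : ℕ → ℤ) →
  sumRange (k * a) (k * len) g ≡ sumRange a len (λ m → sumFinℤ k (λ b → g (k * m + toℕ b)))
sumRange-digits k a zero      g = cong (λ n → sumRange (k * a) n g) (ℕP.*-zeroʳ k)
sumRange-digits k a (suc len) g = begin
  sumRange (k * a) (k * suc len) g
    ≡⟨ cong (λ n → sumRange (k * a) n g) (ℕP.*-suc k len) ⟩
  sumRange (k * a) (k + k * len) g
    ≡⟨ sumRange-+ (k * a) k (k * len) g ⟩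
  sumRange (k * a) k g ℤ.+ sumRange (k * a + k) (k * len) g
    ≡⟨ cong₂ ℤ._+_ (sumRange≡sumFinℤ (k * a) k g) next-blocks ⟩
  sumRange a (suc len) (λ m → sumFinℤ k (λ b → g (k * m + toℕ b))) ∎
  where
    open ≡-Reasoning
    k[a+1]≡ka+k : k * suc a ≡ k * a + k
    k[a+1]≡ka+k = trans (ℕP.*-suc k a) (ℕP.+-comm k (k * a))
    next-blocks : sumRange (k * a + k) (k * len) g
                ≡ sumRange (suc a) len (λ m → sumFinℤ k (λ b → g (k * m + toℕ b)))
    next-blocks = trans (cong (λ c → sumRange c (k * len) g) (sym k[a+1]≡ka+k))
                        (sumRange-digits k (suc a) len g)

sumRange-nonNeg : ∀ a len (g : ℕ → ℤ) → (∀ m → 0ℤ ℤ.≤ g m) → 0ℤ ℤ.≤ sumRange a len g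
sumRange-nonNeg a zero      g g≥0 = ℤP.≤-refl
sumRange-nonNeg a (suc len) g g≥0 = ℤP.+-mono-≤ (g≥0 a) (sumRange-nonNeg (suc a) len g g≥0)

sumRange-pos : ∀ a len (g : ℕ → ℤ) → (∀ m → 0ℤ ℤ.≤ g m) →
  ∀ m → a ≤ m → m < a + len → 0ℤ ℤ.< g m → 0ℤ ℤ.< sumRange a len g
sumRange-pos a zero      g g≥0 m a≤m m<a+0 gm>0 =
  ⊥-elim (ℕP.<-irrefl refl (ℕP.<-≤-trans m<a+0 (subst (_≤ m) (sym (ℕP.+-identityʳ a)) a≤m)))
sumRange-pos a (suc len) g g≥0 m a≤m m<a+1+len gm>0 with a ℕP.≟ m
... | yes refl = ℤP.+-mono-<-≤ gm>0 (sumRange-nonNeg (suc a) len g g≥0)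
... | no  a≢m  = ℤP.+-mono-≤-< (g≥0 a)
  (sumRange-pos (suc a) len g g≥0 m (ℕP.≤∧≢⇒< a≤m a≢m) (subst (m <_) (ℕP.+-suc a len) m<a+1+len) gm>0)

blockSum-pos : ∀ k .{{_ : NonZero k}} p (g : ℕ → ℤ) → (∀ m → 0ℤ ℤ.≤ g m) →
  ∀ m → k ^ p ≤ m → m < k ^ suc p → 0ℤ ℤ.< g m → 0ℤ ℤ.< blockSum k g p
blockSum-pos k p g g≥0 m k^p≤m m<k^[p+1] =
  sumRange-pos (k ^ p) (k ^ suc p ∸ k ^ p) g g≥0 m k^p≤m
    (subst (m <_) (sym (ℕP.m+[n∸m]≡n (ℕP.m≤n*m (k ^ p) k))) m<k^[p+1])

/1-homo-+ : ∀ a b → (a ℤ.+ b) ℚ./ 1 ≡ (a ℚ./ 1) ℚ.+ (b ℚ./ 1)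
/1-homo-+ a b = trans
  (cong (ℚ._/ 1) (sym (cong₂ ℤ._+_ (ℤP.*-identityʳ a) (ℤP.*-identityʳ b))))
  (sym (cong₂ ℚ._+_ (/1≡mkℚ a) (/1≡mkℚ b)))
  where
    /1≡mkℚ : ∀ i → i ℚ./ 1 ≡ ℚ.mkℚ i 0 (Coprimality.sym (1-coprimeTo _))
    /1≡mkℚ i = ℚP.↥p/↧p≡p (ℚ.mkℚ i 0 (Coprimality.sym (1-coprimeTo _)))

sumFinℚ-/1 : ∀ n (g : Fin n → ℤ) → sumFinℚ n (λ j → g j ℚ./ 1) ≡ sumFinℤ n g ℚ./ 1
sumFinℚ-/1 zero    g = refl
sumFinℚ-/1 (suc n) g = trans (cong ((g Fin.zero ℚ./ 1) ℚ.+_) (sumFinℚ-/1 n _))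
  (sym (/1-homo-+ (g Fin.zero) _))

/1-nonNeg : ∀ {i} → 0ℤ ℤ.≤ i → ℚ.NonNegative (i ℚ./ 1)
/1-nonNeg {ℤ.+ n} _ = ℚP.normalize-nonNeg n 1

/1-pos : ∀ {i} → 0ℤ ℤ.< i → ℚ.Positive (i ℚ./ 1)
/1-pos {ℤ.+[1+ n ]} _ = ℚP.normalize-pos (suc n) 1
/1-pos {ℤ.+ zero} (ℤ.+<+ ())

/'≡*1/ : ∀ p q .{{_ : ℚ.Positive q}} → p /' q ≡ p ℚ.* (ℚ.1/ q) {{ℚP.pos⇒nonZero q}}
/'≡*1/ p q with q ℚ.≟ 0ℚ
... | yes q≡0 = ⊥-elim (ℚP.<-irrefl (sym q≡0) (ℚP.positive⁻¹ q))
... | no  _   = refl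

normalisedRow : ∀ n (X : Fin n → ℤ) Y → (∀ j → 0ℤ ℤ.≤ X j) → 0ℤ ℤ.< Y → sumFinℤ n X ≡ Y →
  (∀ j → 0ℚ ℚ.≤ (X j ℚ./ 1) /' (Y ℚ./ 1))
  × sumFinℚ n (λ j → (X j ℚ./ 1) /' (Y ℚ./ 1)) ≡ 1ℚ
normalisedRow n X Y X≥0 Y>0 ΣX≡Y = entry≥0 , row≡1
  where
    y = Y ℚ./ 1
    instance
      y-pos : ℚ.Positive y
      y-pos = /1-pos Y>0
      y-nonZero : ℚ.NonZero y
      y-nonZero = ℚP.pos⇒nonZero y

    entry≥0 : ∀ j → 0ℚ ℚ.≤ (X j ℚ./ 1) /' y
    entry≥0 j = subst (0ℚ ℚ.≤_) (sym (/'≡*1/ (X j ℚ./ 1) y))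
      (ℚP.nonNegative⁻¹ _ {{ℚP.nonNeg*nonNeg⇒nonNeg (X j ℚ./ 1) {{/1-nonNeg (X≥0 j)}} (ℚ.1/ y)
                             {{ℚP.pos⇒nonNeg (ℚ.1/ y) {{ℚP.1/pos⇒pos y}}}}}})

    row≡1 : sumFinℚ n (λ j → (X j ℚ./ 1) /' y) ≡ 1ℚ
    row≡1 = begin
      sumFinℚ n (λ j → (X j ℚ./ 1) /' y)       ≡⟨ sumFinℚ-cong n (λ j → /'≡*1/ (X j ℚ./ 1) y) ⟩
      sumFinℚ n (λ j → (X j ℚ./ 1) ℚ.* ℚ.1/ y) ≡⟨ sumFinℚ-distribʳ n (λ j → X j ℚ./ 1) (ℚ.1/ y) ⟩
      sumFinℚ n (λ j → X j ℚ./ 1) ℚ.* ℚ.1/ y   ≡⟨ cong (ℚ._* ℚ.1/ y) (sumFinℚ-/1 n X) ⟩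
      (sumFinℤ n X ℚ./ 1) ℚ.* ℚ.1/ y           ≡⟨ cong (λ Z → (Z ℚ./ 1) ℚ.* ℚ.1/ y) ΣX≡Y ⟩
      y ℚ.* ℚ.1/ y                             ≡⟨ ℚP.*-inverseʳ y ⟩
      1ℚ                                       ∎
      where open ≡-Reasoning

module DigitRecurrence
  (k : ℕ) (1<k : 1 < k) (d : ℕ)
  (F : Fin d → ℕ → ℤ) (B : Fin k → Fin d → Fin d → ℤ)
  (F-digit : ∀ (a : Fin k) m i → F i (k * m + toℕ a) ≡ sumFinℤ d (λ j → B a i j ℤ.* F j m))
  where

  instance
    k-nonZero : NonZero k
    k-nonZero = ℕ.>-nonZero (ℕP.<-trans ℕ.z<s 1<k)

  digitSum : ∀ i m →
    sumFinℤ k (λ a → F i (k * m + toℕ a)) ≡ sumFinℤ d (λ j → Bat1 k d B i j ℤ.* F j m)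
  digitSum i m = begin
    sumFinℤ k (λ a → F i (k * m + toℕ a))
      ≡⟨ sumFinℤ-cong k (λ a → F-digit a m i) ⟩
    sumFinℤ k (λ a → sumFinℤ d (λ j → B a i j ℤ.* F j m))
      ≡⟨ sumFinℤ-comm k d (λ a j → B a i j ℤ.* F j m) ⟩
    sumFinℤ d (λ j → sumFinℤ k (λ a → B a i j ℤ.* F j m))
      ≡⟨ sumFinℤ-cong d (λ j → sumFinℤ-distribʳ k (λ a → B a i j) (F j m)) ⟩
    sumFinℤ d (λ j → Bat1 k d B i j ℤ.* F j m) ∎
    where open ≡-Reasoning

  blockSum-suc : ∀ i p →
    blockSum k (F i) (suc p) ≡ sumFinℤ d (λ j → blockSum k (F j) p ℤ.* Bat1 k d B i j)
  blockSum-suc i p = begin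
    sumRange (k * k ^ p) (k ^ suc (suc p) ∸ k ^ suc p) (F i)
      ≡⟨ cong (λ n → sumRange (k * k ^ p) n (F i)) (sym (ℕP.*-distribˡ-∸ k (k ^ suc p) (k ^ p))) ⟩
    sumRange (k * k ^ p) (k * len) (F i)
      ≡⟨ sumRange-digits k (k ^ p) len (F i) ⟩
    sumRange (k ^ p) len (λ m → sumFinℤ k (λ a → F i (k * m + toℕ a)))
      ≡⟨ sumRange-cong (k ^ p) len (digitSum i) ⟩
    sumRange (k ^ p) len (λ m → sumFinℤ d (λ j → Bat1 k d B i j ℤ.* F j m))
      ≡⟨ sumRange≡sumFinℤ (k ^ p) len _ ⟩
    sumFinℤ len (λ t → sumFinℤ d (λ j → Bat1 k d B i j ℤ.* F j (k ^ p + toℕ t)))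
      ≡⟨ sumFinℤ-comm len d (λ t j → Bat1 k d B i j ℤ.* F j (k ^ p + toℕ t)) ⟩
    sumFinℤ d (λ j → sumFinℤ len (λ t → Bat1 k d B i j ℤ.* F j (k ^ p + toℕ t)))
      ≡⟨ sumFinℤ-cong d (λ j → sumFinℤ-cong len (λ t → ℤP.*-comm (Bat1 k d B i j) _)) ⟩
    sumFinℤ d (λ j → sumFinℤ len (λ t → F j (k ^ p + toℕ t) ℤ.* Bat1 k d B i j))
      ≡⟨ sumFinℤ-cong d (λ j → sumFinℤ-distribʳ len (λ t → F j (k ^ p + toℕ t)) (Bat1 k d B i j)) ⟩
    sumFinℤ d (λ j → sumFinℤ len (λ t → F j (k ^ p + toℕ t)) ℤ.* Bat1 k d B i j)
      ≡⟨ sumFinℤ-cong d (λ j → cong (ℤ._* Bat1 k d B i j) (sym (sumRange≡sumFinℤ (k ^ p) len (F j)))) ⟩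
    sumFinℤ d (λ j → blockSum k (F j) p ℤ.* Bat1 k d B i j) ∎
    where
      open ≡-Reasoning
      len = k ^ suc p ∸ k ^ p

  digits : ∀ m → m ≡ k * (m / k) + toℕ (m mod k)
  digits m = trans (DivMod.property (m divMod k))
    (trans (ℕP.+-comm (toℕ (m mod k)) _) (cong (_+ toℕ (m mod k)) (ℕP.*-comm (m / k) k)))

  quotient-≥ : ∀ p m → k ^ suc p ≤ m → k ^ p ≤ m / k
  quotient-≥ p m k^[p+1]≤m = subst (_≤ m / k) (m*n/n≡m (k ^ p) k)
    (/-monoˡ-≤ k (subst (_≤ m) (ℕP.*-comm k (k ^ p)) k^[p+1]≤m))

  quotient-< : ∀ p m → k ^ suc p ≤ m → m / k < m
  quotient-< p m k^[p+1]≤m =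
    m/n<m m k {{ℕ.>-nonZero (ℕP.<-≤-trans (ℕP.m^n>0 k (suc p)) k^[p+1]≤m)}} 1<k

  module Nonnegative (F≥0 : ∀ i m → 0ℤ ℤ.≤ F i m) (B≥0 : ∀ a i j → 0ℤ ℤ.≤ B a i j) where

    digit-descent : ∀ a q j → 0ℤ ℤ.< F j (k * q + toℕ a) → ∃ λ l → 0ℤ ℤ.< F l q
    digit-descent a q j Fj>0
      with sumFinℤ-pos⇒∃pos d _ (subst (0ℤ ℤ.<_) (F-digit a q j) Fj>0)
    ... | l , BF>0 = l , i*j>0∧j≥0⇒j>0 (B a j l) (F≥0 l q) BF>0

    -- Strip the last digit of m until it lands in the block [k^p, k^(p+1)).
    positive-block : ∀ p m j → k ^ p ≤ m → 0ℤ ℤ.< F j m → ∃ λ l → 0ℤ ℤ.< blockSum k (F l) p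
    positive-block p = <-rec _ descend
      where
        descend : ∀ m → (∀ {q} → q < m → ∀ j → k ^ p ≤ q → 0ℤ ℤ.< F j q →
                                  ∃ λ l → 0ℤ ℤ.< blockSum k (F l) p) →
                  ∀ j → k ^ p ≤ m → 0ℤ ℤ.< F j m → ∃ λ l → 0ℤ ℤ.< blockSum k (F l) p
        descend m rec j k^p≤m Fjm>0 with m ℕP.<? k ^ suc p
        ... | yes m<k^[p+1] = j , blockSum-pos k p (F j) (F≥0 j) m k^p≤m m<k^[p+1] Fjm>0
        ... | no  m≮k^[p+1]
          with digit-descent (m mod k) (m / k) j (subst (λ n → 0ℤ ℤ.< F j n) (digits m) Fjm>0)
        ...   | l , Flq>0 = rec (quotient-< p m (ℕP.≮⇒≥ m≮k^[p+1])) l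
                              (quotient-≥ p m (ℕP.≮⇒≥ m≮k^[p+1])) Flq>0

    blockSum-nonNeg : ∀ i p → 0ℤ ℤ.≤ blockSum k (F i) p
    blockSum-nonNeg i p = sumRange-nonNeg (k ^ p) (k ^ suc p ∸ k ^ p) (F i) (F≥0 i)

    Bat1-nonNeg : ∀ i j → 0ℤ ℤ.≤ Bat1 k d B i j
    Bat1-nonNeg i j = sumFinℤ-nonNeg k (λ a → B a i j) (λ a → B≥0 a i j)

    blockSum-suc-pos : (∀ i j → 0ℤ ℤ.< Bat1 k d B i j) →
      ∀ p → (∃ λ l → 0ℤ ℤ.< blockSum k (F l) p) → ∀ i → 0ℤ ℤ.< blockSum k (F i) (suc p)
    blockSum-suc-pos Bat1>0 p (l , Σl>0) i = subst (0ℤ ℤ.<_) (sym (blockSum-suc i p))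
      (sumFinℤ-pos d _ (λ j → i≥0∧j≥0⇒i*j≥0 (blockSum-nonNeg j p) (Bat1-nonNeg i j))
                   l (i>0∧j>0⇒i*j>0 Σl>0 (Bat1>0 i l)))

corollary3p2 : (k : ℕ) → 2 ≤ k →
    (f : ℕ → ℤ) →
    (e : ℕ) → (ℓ r : Fin (suc e) → ℕ) →
    (∀ i → r i < k ^ ℓ i) →
    ℓ Fin.zero ≡ 0 → r Fin.zero ≡ 0 →
    (∀ (c : Fin (suc e) → ℚ) →
       (∀ m → sumFinℚ (suc e) (λ i → c i ℚ.* (f (k ^ ℓ i * m + r i) ℚ./ 1)) ≡ ℚ.0ℚ) →
       ∀ i → c i ≡ ℚ.0ℚ) →
    (∀ (l : ℕ) (s : ℕ) → s < k ^ l →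
       Σ (Fin (suc e) → ℚ) λ c → ∀ m →
         f (k ^ l * m + s) ℚ./ 1
           ≡ sumFinℚ (suc e) (λ i → c i ℚ.* (f (k ^ ℓ i * m + r i) ℚ./ 1))) →
    (B : Fin k → Fin (suc e) → Fin (suc e) → ℤ) →
    (∀ (a : Fin k) (m : ℕ) (i : Fin (suc e)) →
       f (k ^ ℓ i * (k * m + toℕ a) + r i)
         ≡ sumFinℤ (suc e) (λ j → B a i j ℤ.* f (k ^ ℓ j * m + r j))) →
    (∀ n → ℤ.0ℤ ℤ.≤ f n) →
    (∀ N → Σ ℕ λ n → N ≤ n × f n ≢ ℤ.0ℤ) →
    (∀ a i j → ℤ.0ℤ ℤ.≤ B a i j) →
    (∀ i j → ℤ.0ℤ ℤ.< Bat1 k (suc e) B i j) →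
    ∀ (n : ℕ) → 1 ≤ n →
      let fs = λ (i : Fin (suc e)) (m : ℕ) → f (k ^ ℓ i * m + r i) in
      (∀ i j → ℚ.0ℚ ℚ.≤ A1 k (suc e) fs B n i j) ×
      (∀ i → sumFinℚ (suc e) (λ j → A1 k (suc e) fs B n i j) ≡ ℚ.1ℚ)
corollary3p2 k 1<k f e ℓ r _ ℓ₀≡0 r₀≡0 _ _ B F-digit f≥0 f-infinite B≥0 Bat1>0 (suc p) _ =
  (λ i → proj₁ (row i)) , (λ i → proj₂ (row i))
  where
    F : Fin (suc e) → ℕ → ℤ
    F i m = f (k ^ ℓ i * m + r i)

    open DigitRecurrence k 1<k (suc e) F B F-digit
    open Nonnegative (λ i m → f≥0 _) B≥0

    F₀≡f : ∀ m → F Fin.zero m ≡ f m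
    F₀≡f m rewrite ℓ₀≡0 | r₀≡0 = cong f (trans (ℕP.+-identityʳ _) (ℕP.*-identityˡ m))

    some-block-pos : ∃ λ l → 0ℤ ℤ.< blockSum k (F l) p
    some-block-pos with f-infinite (k ^ p)
    ... | m , k^p≤m , fm≢0 = positive-block p m Fin.zero k^p≤m
      (subst (0ℤ ℤ.<_) (sym (F₀≡f m)) (ℤP.≤∧≢⇒< (f≥0 m) (λ 0≡fm → fm≢0 (sym 0≡fm))))

    row : ∀ i → (∀ j → 0ℚ ℚ.≤ A1 k (suc e) F B (suc p) i j)
                × sumFinℚ (suc e) (λ j → A1 k (suc e) F B (suc p) i j) ≡ 1ℚ
    row i = normalisedRow (suc e) (λ j → blockSum k (F j) p ℤ.* Bat1 k (suc e) B i j)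
      (blockSum k (F i) (suc p))
      (λ j → i≥0∧j≥0⇒i*j≥0 (blockSum-nonNeg j p) (Bat1-nonNeg i j))
      (blockSum-suc-pos Bat1>0 p some-block-pos i)
      (sym (blockSum-suc i p))
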